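{- Let $t\ge1$, $n=2(t+1)^2$, let $\mathcal{C}_0\subseteq\mathbb{Z}_n^2$ be a linear $t$-error-correcting diameter perfect code with generator matrix $G_0$, and let $\mathcal{C}=\mathbf{x}+\mathcal{C}_0$ for some $\mathbf{x}=(x_1,x_2)\in\mathbb{Z}_n^2$, with $\mathcal{C}$ of Case I or Case II. Let $\mathcal{S}$ be the set of diameter perfect Sudoku grids with respect to $\mathcal{C}$ and $\mathcal{A}$, and $\bar{\mathcal{S}}$ its set of relabeling classes, on which a group $\mathcal{G}_\mathcal{S}$ acts by $g\cdot[S]=[g(S)]$. (i) If $\mathcal{C}$ is of Case I and $\mathcal{G}_\mathcal{S}=\langle \tau_1^{t+1}\tau_2^{t+1},\ \tau_2^{2(t+1)},\ \tau_2^{2x_2+1}s,\ \tau_1^{2x_1+2}\tau_2^{2x_2+1}r^2\rangle$, then each equivalence class in $\bar{\mathcal{S}}$ under the action of $\mathcal{G}_\mathcal{S}$ has size dividing $4n$. (ii) If $\mathcal{C}$ is of Case II, $G_0=[a~~b]$, and $\mathcal{G}_\mathcal{S}=\langle \tau_1^{a}\tau_2^{b},\ \tau_1^{2x_1+2}\tau_2^{2x_2+1}r^2\rangle$, then each equivalence class in $\bar{\mathcal{S}}$ under the action of $\mathcal{G}_\mathcal{S}$ has size dividing $2n$.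
   Context: $\mathbb{Z}_n$ is the ring of integers modulo $n$; Lee weight of $\mathbf{u}=(u_1,u_2)$ (entries in $\{0,\dots,n-1\}$) is $\sum_i\min\{u_i,n-u_i\}$, Lee distance $d_L(\mathbf{u},\mathbf{v})=\mathrm{wt}_L(\mathbf{u}-\mathbf{v})$. A code is a subset of $\mathbb{Z}_n^2$, linear if a submodule; the code with a generator matrix is the $\mathbb{Z}_n$-span of its rows. Codes $\mathcal{C}_1,\mathcal{C}_2$ are equivalent if $\mathcal{C}_1P=\mathcal{C}_2$ for a permutation matrix $P$. For $\mathbf{c}\in\mathcal{C}$, $\mathcal{A}(\mathbf{c})$ is the set of points at Lee distance at most $t$ from $\mathbf{c}$ or from $\mathbf{c}+(1,0)$ (a translate of the anticode $\mathcal{A}_{2t+1}$, of size $n$, with core $\{\mathbf{c},\mathbf{c}+(1,0)\}$). A $t$-error-correcting diameter perfect code is a code of minimum Lee distance $2t+2$ with $|\mathcal{C}|\cdot|\mathcal{A}_{2t+1}|=n^2$; then the $\mathcal{A}(\mathbf{c})$ partition $\mathbb{Z}_n^2$. For $\mathcal{C}=\{\mathbf{c}_1,\dots,\mathbf{c}_n\}$ the palette grid $\mathcal{I}_{\mathcal{C},\mathcal{A}}$ is the $n\times n$ array (indices $0,\dots,n-1$) with entry $i$ on $\mathcal{A}(\mathbf{c}_i)$. Arrays over $[n]=\{1,\dots,n\}$ are orthogonal if ordered pairs of corresponding entries are pairwise distinct. A diameter perfect Sudoku grid with respect to $\mathcal{C}$ and $\mathcal{A}$ is a Latin square over $[n]$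 orthogonal to $\mathcal{I}_{\mathcal{C},\mathcal{A}}$. $\mathcal{C}'$ is generated by $\begin{bmatrix}t+1&t+1\\0&2(t+1)\end{bmatrix}$, $\mathcal{C}''$ by $[1~~2t+1]$; Case I means $\mathcal{C}_0$ is equivalent to $\mathcal{C}'$, Case II means $\mathcal{C}_0$ is equivalent to $\mathcal{C}''$. Relabeling: $S_1\sim S_2$ if $\sigma((S_1)_{i,j})=(S_2)_{i,j}$ for all $i,j$ for some bijection $\sigma$ of $[n]$. On $n\times n$ arrays (indices mod $n$): $(r(A))_{i,j}=A_{n-1-j,i}$, $(s(A))_{i,j}=A_{i,n-1-j}$, $(\tau_1(A))_{i,j}=A_{i-1,j}$, $(\tau_2(A))_{i,j}=A_{i,j-1}$; products denote composition. (These groups map $\mathcal{S}$ into $\mathcal{S}$, so the actions are well defined.) -}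

module Defs where

open import Data.Nat using (ℕ; zero; suc; _+_; _*_; _∸_; _≤_; _≤ᵇ_; _⊓_; NonZero)
open import Data.Nat.DivMod using (_mod_)
open import Data.Nat.Divisibility using (_∣_)
open import Data.Fin using (Fin; toℕ)
open import Data.Fin.Permutation using (Permutation′; _⟨$⟩ʳ_)
open import Data.Bool using (Bool; true; false; _∨_)
open import Data.List using (List; []; _∷_; _++_; reverse; map; filterᵇ; length; allFin; concatMap)
open import Data.List.Membership.Propositional using (_∈_)
open import Data.Product using (Σ; ∃; _×_; _,_; proj₁; proj₂)
open import Data.Sum using (_⊎_)
open import Function.Bundles using (_⇔_)
open import Relation.Binary.PropositionalEquality using (_≡_; _≢_)
open import Relation.Nullary.Decidable using (does)

-- The modulus n = 2 (t+1)^2  (reduces to a successor, so NonZero is found)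

N : ℕ → ℕ
N t = 2 * (suc t * suc t)

module _ {n : ℕ} {{_ : NonZero n}} where

  infixl 6 _⊕_ _⊖_
  infixl 7 _·_

  _⊕_ : Fin n → Fin n → Fin n
  a ⊕ b = (toℕ a + toℕ b) mod n

  _⊖_ : Fin n → Fin n → Fin n
  a ⊖ b = (toℕ a + (n ∸ toℕ b)) mod n

  _·_ : Fin n → Fin n → Fin n
  k · a = (toℕ k * toℕ a) mod n

  zeroZ oneZ : Fin n
  zeroZ = 0 mod n
  oneZ  = 1 mod n

  flipZ : Fin n → Fin n
  flipZ j = (n ∸ 1 ∸ toℕ j) mod n

Cell : ℕ → Set
Cell n = Fin n × Fin n

module _ {n : ℕ} {{_ : NonZero n}} where

  infixl 6 _⊕²_ _⊖²_
  infixl 7 _·²_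

  _⊕²_ : Cell n → Cell n → Cell n
  (a₁ , a₂) ⊕² (b₁ , b₂) = (a₁ ⊕ b₁ , a₂ ⊕ b₂)

  _⊖²_ : Cell n → Cell n → Cell n
  (a₁ , a₂) ⊖² (b₁ , b₂) = (a₁ ⊖ b₁ , a₂ ⊖ b₂)

  _·²_ : Fin n → Cell n → Cell n
  k ·² (a₁ , a₂) = (k · a₁ , k · a₂)

  zero² : Cell n
  zero² = (zeroZ , zeroZ)

  e₁ : Cell n
  e₁ = (oneZ , zeroZ)

  swap² : Cell n → Cell n
  swap² (a₁ , a₂) = (a₂ , a₁)

  wLee : Fin n → ℕ
  wLee u = toℕ u ⊓ (n ∸ toℕ u)

  wtL : Cell n → ℕ
  wtL (u₁ , u₂) = wLee u₁ + wLee u₂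

  dL : Cell n → Cell n → ℕ
  dL u v = wtL (u ⊖² v)

Code : ℕ → Set
Code n = Cell n → Bool

allCells : (n : ℕ) → List (Cell n)
allCells n = concatMap (λ i → map (λ j → (i , j)) (allFin n)) (allFin n)

card : {n : ℕ} → (Cell n → Bool) → ℕ
card {n} C = length (filterᵇ C (allCells n))

module _ {n : ℕ} {{_ : NonZero n}} where

  Linear : Code n → Set
  Linear C = (C zero² ≡ true)
           × (∀ p q → C p ≡ true → C q ≡ true → C (p ⊕² q) ≡ true)
           × (∀ k p → C p ≡ true → C (k ·² p) ≡ true)

  -- Z_n-span of the rows of a matrix (given as a list of rows)
  Span : List (Cell n) → Cell n → Set
  Span []       p = p ≡ zero²
  Span (v ∷ vs) p = Σ (Fin n) λ k → Σ (Cell n) λ q → Span vs q × (p ≡ (k ·² v) ⊕² q)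

  GeneratorMatrix : List (Cell n) → Code n → Set
  GeneratorMatrix G C = ∀ p → (C p ≡ true) ⇔ Span G p

  MinLeeDistance : Code n → ℕ → Set
  MinLeeDistance C d =
      (∀ p q → C p ≡ true → C q ≡ true → p ≢ q → d ≤ dL p q)
    × (Σ (Cell n) λ p → Σ (Cell n) λ q → C p ≡ true × C q ≡ true × p ≢ q × dL p q ≡ d)

  inA : ℕ → Cell n → Cell n → Bool
  inA t c p = (dL p c ≤ᵇ t) ∨ (dL p (c ⊕² e₁) ≤ᵇ t)

  DiameterPerfect : ℕ → Code n → Set
  DiameterPerfect t C = MinLeeDistance C (2 * t + 2)
                      × (card C * card (inA t zero²) ≡ n * n)

  translate : Cell n → Code n → Code n
  translate x C p = C (p ⊖² x)

  -- C1 P = C2 for a 2×2 permutation matrix P (identity or swap)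
  Equivalent : Code n → (Cell n → Set) → Set
  Equivalent C₁ C₂ = (∀ p → (C₁ p ≡ true) ⇔ C₂ p)
                   ⊎ (∀ p → (C₁ (swap² p) ≡ true) ⇔ C₂ p)

C′ : (t : ℕ) → Cell (N t) → Set
C′ t = Span (((suc t) mod (N t) , (suc t) mod (N t))
            ∷ (0 mod (N t) , (2 * suc t) mod (N t)) ∷ [])

C″ : (t : ℕ) → Cell (N t) → Set
C″ t = Span ((1 mod (N t) , (2 * t + 1) mod (N t)) ∷ [])

Arr : ℕ → Set
Arr n = Fin n → Fin n → Fin n

module _ {n : ℕ} where

  Latin : Arr n → Set
  Latin A = (∀ i k → Σ (Fin n) λ j → A i j ≡ k × (∀ j′ → A i j′ ≡ k → j′ ≡ j))
          × (∀ j k → Σ (Fin n) λ i → A i j ≡ k × (∀ i′ → A i′ j ≡ k → i′ ≡ i))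

  Orthogonal : Arr n → Arr n → Set
  Orthogonal A B = ∀ i j i′ j′ → A i j ≡ A i′ j′ → B i j ≡ B i′ j′ → (i , j) ≡ (i′ , j′)

  Enumerates : Code n → (Fin n → Cell n) → Set
  Enumerates C e = (∀ i j → e i ≡ e j → i ≡ j) × (∀ p → (C p ≡ true) ⇔ (Σ (Fin n) λ i → e i ≡ p))

module _ {n : ℕ} {{_ : NonZero n}} where

  IsPalette : ℕ → (Fin n → Cell n) → Arr n → Set
  IsPalette t e I = ∀ u₁ u₂ i → (I u₁ u₂ ≡ i) ⇔ (inA t (e i) (u₁ , u₂) ≡ true)

  IsDPSudoku : Arr n → Arr n → Set
  IsDPSudoku I S = Latin S × Orthogonal S I

Relabel : {n : ℕ} → Arr n → Arr n → Set
Relabel {n} S₁ S₂ = Σ (Permutation′ n) λ σ → ∀ i j → σ ⟨$⟩ʳ (S₁ i j) ≡ S₂ i j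

data Letter : Set where
  r s τ₁ τ₂ r⁻ s⁻ τ₁⁻ τ₂⁻ : Letter

invL : Letter → Letter
invL r = r⁻
invL s = s⁻
invL τ₁ = τ₁⁻
invL τ₂ = τ₂⁻
invL r⁻ = r
invL s⁻ = s
invL τ₁⁻ = τ₁
invL τ₂⁻ = τ₂

Word : Set
Word = List Letter

invW : Word → Word
invW w = reverse (map invL w)

_^^_ : Word → ℕ → Word
w ^^ zero  = []
w ^^ suc k = w ++ (w ^^ k)

module _ {n : ℕ} {{_ : NonZero n}} where

  actL : Letter → Arr n → Arr n
  actL r   A i j = A (flipZ j) i
  actL s   A i j = A i (flipZ j)
  actL τ₁  A i j = A (i ⊖ oneZ) j
  actL τ₂  A i j = A i (j ⊖ oneZ)
  actL r⁻  A i j = A j (flipZ i)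
  actL s⁻  A i j = A i (flipZ j)
  actL τ₁⁻ A i j = A (i ⊕ oneZ) j
  actL τ₂⁻ A i j = A i (j ⊕ oneZ)

  -- a word denotes the composition of its letters (leftmost applied last)
  act : Word → Arr n → Arr n
  act []      A = A
  act (l ∷ w) A = actL l (act w A)

data InGroup (gens : List Word) : Word → Set where
  ε    : InGroup gens []
  gen  : ∀ {w v} → w ∈ gens → InGroup gens v → InGroup gens (w ++ v)
  gen⁻ : ∀ {w v} → w ∈ gens → InGroup gens v → InGroup gens (invW w ++ v)

-- the class of [S] under the action g·[S] = [g(S)] of ⟨gens⟩ on relabeling
-- classes has exactly m elements: L lists its members without repetition
OrbitSize : {n : ℕ} {{_ : NonZero n}} → List Word → Arr n → ℕ → Set
OrbitSize {n} gens S m =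
  Σ (Fin m → Arr n) λ L →
      (∀ k → Σ Word λ w → InGroup gens w × Relabel (act w S) (L k))
    × (∀ k l → Relabel (L k) (L l) → k ≡ l)
    × (∀ w → InGroup gens w → Σ (Fin m) λ k → Relabel (act w S) (L k))

OrbitSizeDivides : {n : ℕ} {{_ : NonZero n}} → List Word → Arr n → ℕ → Set
OrbitSizeDivides gens S d = Σ ℕ λ m → OrbitSize gens S m × m ∣ d

τ^ : Letter → ℕ → Word
τ^ l k = (l ∷ []) ^^ k

module _ (t : ℕ) (x : Cell (N t)) where

  x₁ x₂ : ℕ
  x₁ = toℕ (proj₁ x)
  x₂ = toℕ (proj₂ x)

  gRot : Word
  gRot = τ^ τ₁ (2 * x₁ + 2) ++ τ^ τ₂ (2 * x₂ + 1) ++ (r ∷ r ∷ [])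

  gensI : List Word
  gensI = (τ^ τ₁ (suc t) ++ τ^ τ₂ (suc t))
        ∷ τ^ τ₂ (2 * suc t)
        ∷ (τ^ τ₂ (2 * x₂ + 1) ++ (s ∷ []))
        ∷ gRot
        ∷ []

  gensII : Fin (N t) → Fin (N t) → List Word
  gensII a b = (τ^ τ₁ (toℕ a) ++ τ^ τ₂ (toℕ b)) ∷ gRot ∷ []

module Submission where

-- Each word w acts on arrays by re-indexing, act w A = A ∙ pos w, where pos w permutes the
-- cells of Z_n².  For the generators these are affine maps with linear part ±1 in each
-- coordinate: the translations U = τ₁^(t+1) τ₂^(t+1), V = τ₂^(2(t+1)) and the reflections
-- F = τ₂^(2x₂+1) s, G = τ₁^(2x₁+2) τ₂^(2x₂+1) r² in Case I; the translation T = τ₁^a τ₂^b and G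
-- in Case II.  Taken in this order, they have orders dividing 2(t+1), t+1, 2, 2 (resp. n, 2),
-- and each conjugates the earlier ones into the group they generate.  Adjoining such an h to
-- a group K multiplies the size of the orbit of [S] by the least e > 0 for which [S ∙ h^e]
-- lies in the K-orbit, and e divides the order of h; so the orbit size divides the product of
-- the orders, 4n resp. 2n.

open import Defs
open import Data.Empty using (⊥-elim)
open import Data.Fin using (Fin; toℕ; zero; fromℕ<; combine; remQuot)
open import Data.Fin.Permutation using (_⟨$⟩ʳ_; _⟨$⟩ˡ_; inverseˡ; inverseʳ; _∘ₚ_; permutation)
import Data.Fin.Permutation as Perm
open import Data.Fin.Properties
  using (toℕ-fromℕ<; toℕ-injective; toℕ<n; toℕ≤pred[n]; combine-remQuot; remQuot-combine; any?; all?; _≟_)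
open import Data.List using (List; []; _∷_; _++_; [_])
import Data.List as List
open import Data.List.Membership.Propositional using (_∈_)
open import Data.List.Properties using (unfold-reverse; ++-assoc; ++-identityʳ)
open import Data.List.Relation.Unary.All using (All; []; _∷_)
import Data.List.Relation.Unary.All as All
open import Data.List.Relation.Unary.Any using (here; there)
open import Data.Nat using (ℕ; zero; suc; _+_; _*_; _∸_; _≤_; _<_; s≤s; NonZero; >-nonZero⁻¹)
open import Data.Nat.DivMod
  using (_%_; _/_; _mod_; m%n<n; m≡m%n+[m/n]*n; %-distribˡ-+; %-distribˡ-*; m*n%n≡0; m%n%n≡m%n; m<n⇒m%n≡m)
open import Data.Nat.Divisibility using (_∣_; m%n≡0⇒n∣m; *-pres-∣; ∣-refl)
open import Data.Nat.Properties
  using (+-comm; +-assoc; +-identityʳ; *-comm; *-assoc; *-identityˡ; *-identityʳ; *-zeroʳ; *-distribˡ-+;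
         <⇒≤; ≤-total; ≤-<-trans; m≤m+n; m≤n⇒∃[o]m+o≡n; m≤n⇒m<n∨m≡n; m+[n∸m]≡n; m∸n+n≡m)
open import Data.Nat.Tactic.RingSolver using (solve-∀)
open import Data.Product using (_,_; _×_; uncurry; ∃; ∃₂; proj₁; proj₂)
import Data.Product as Product
open import Data.Sum using (inj₁; inj₂)
open import Function using (_∘_; id)
open import Level using (0ℓ)
open import Relation.Binary.Bundles using (Setoid)
import Relation.Binary.Construct.On as On
open import Relation.Binary.PropositionalEquality hiding ([_])
import Relation.Binary.Reasoning.Setoid as SetoidReasoning
open import Relation.Nullary using (Dec; yes; no; ¬_)
open import Relation.Unary using (Decidable)

least : ∀ {P : ℕ → Set} → Decidable P → ∀ {k} → P k → ∃ λ e → P e × (∀ d → d < e → ¬ P d)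
least P? {zero} P0 = 0 , P0 , λ d ()
least P? {suc k} Pk with P? 0
... | yes P0  = 0 , P0 , λ d ()
... | no ¬P0 = let (e , Pe , below) = least (P? ∘ suc) Pk in
  suc e , Pe , λ { zero _ → ¬P0 ; (suc d) (s≤s d<e) → below d d<e }

least-positive-divides : ∀ {P : ℕ → Set} e .{{_ : NonZero e}} → (∀ q → P (q * e)) →
  (∀ {a b} → P (a + b) → P a → P b) → (∀ d → d < e → P d → d ≡ 0) → ∀ {M} → P M → e ∣ M
least-positive-divides {P} e multiples differences below {M} PM =
  m%n≡0⇒n∣m M e (below (M % e) (m%n<n M e) (differences P[q*e+r] (multiples (M / e))))
  where
  P[q*e+r] : P (M / e * e + M % e)
  P[q*e+r] = subst P (trans (m≡m%n+[m/n]*n M e) (+-comm (M % e) _)) PM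

module _ {n : ℕ} {{_ : NonZero n}} where

  open import Function.Endo.Propositional (Cell n) public using (_^_; ^-homo)

  -- Arithmetic modulo n

  infix 4 _≡ₙ_
  _≡ₙ_ : ℕ → ℕ → Set
  a ≡ₙ b = a % n ≡ b % n

  ≡ₙ-setoid : Setoid 0ℓ 0ℓ
  ≡ₙ-setoid = On.setoid (setoid ℕ) (_% n)

  module ≡ₙ-Reasoning = SetoidReasoning ≡ₙ-setoid

  +-congₙ : ∀ {a a′ b b′} → a ≡ₙ a′ → b ≡ₙ b′ → a + b ≡ₙ a′ + b′
  +-congₙ {a} {a′} {b} {b′} a≡a′ b≡b′ = begin
    (a + b) % n                ≡⟨ %-distribˡ-+ a b n ⟩
    (a % n + b % n) % n        ≡⟨ cong₂ (λ x y → (x + y) % n) a≡a′ b≡b′ ⟩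
    (a′ % n + b′ % n) % n      ≡⟨ %-distribˡ-+ a′ b′ n ⟨
    (a′ + b′) % n              ∎
    where open ≡-Reasoning

  *-congₙ : ∀ {a a′ b b′} → a ≡ₙ a′ → b ≡ₙ b′ → a * b ≡ₙ a′ * b′
  *-congₙ {a} {a′} {b} {b′} a≡a′ b≡b′ = begin
    (a * b) % n                ≡⟨ %-distribˡ-* a b n ⟩
    (a % n * (b % n)) % n      ≡⟨ cong₂ (λ x y → (x * y) % n) a≡a′ b≡b′ ⟩
    (a′ % n * (b′ % n)) % n    ≡⟨ %-distribˡ-* a′ b′ n ⟨
    (a′ * b′) % n              ∎
    where open ≡-Reasoning

  ≡k*n⇒≡ₙ0 : ∀ {a} k → a ≡ k * n → a ≡ₙ 0
  ≡k*n⇒≡ₙ0 k refl = trans (m*n%n≡0 k n) (sym (m*n%n≡0 0 n))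

  toℕ-modₙ : ∀ a → toℕ (a mod n) ≡ₙ a
  toℕ-modₙ a = trans (cong (_% n) (toℕ-fromℕ< _)) (m%n%n≡m%n a n)

  mod-congₙ : ∀ {a b} → a ≡ₙ b → a mod n ≡ b mod n
  mod-congₙ {a} {b} a≡b = toℕ-injective (trans (toℕ-fromℕ< _) (trans a≡b (sym (toℕ-fromℕ< _))))

  -- the natural number n ∸ 1 plays the role of −1 in Z_n
  −1ₙ : ℕ
  −1ₙ = n ∸ 1

  1+−1ₙ : 1 + −1ₙ ≡ n
  1+−1ₙ = m+[n∸m]≡n (>-nonZero⁻¹ n)

  −1ₙ-negates : ∀ a → a + −1ₙ * a ≡ₙ 0
  −1ₙ-negates a = ≡k*n⇒≡ₙ0 a (trans (cong (_* a) 1+−1ₙ) (*-comm n a))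

  +-cancelʳ-≡ₙ : ∀ a b c → a + c ≡ₙ b + c → a ≡ₙ b
  +-cancelʳ-≡ₙ a b c a+c≡b+c = begin
    a                     ≡⟨ +-identityʳ a ⟨
    a + 0                 ≈⟨ +-congₙ {a} refl (−1ₙ-negates c) ⟨
    a + (c + −1ₙ * c)     ≡⟨ +-assoc a c _ ⟨
    a + c + −1ₙ * c       ≈⟨ +-congₙ a+c≡b+c refl ⟩
    b + c + −1ₙ * c       ≡⟨ +-assoc b c _ ⟩
    b + (c + −1ₙ * c)     ≈⟨ +-congₙ {b} refl (−1ₙ-negates c) ⟩
    b + 0                 ≡⟨ +-identityʳ b ⟩
    b                     ∎
    where open ≡ₙ-Reasoning

  negate-unique : ∀ a b → a + b ≡ₙ 0 → b ≡ₙ −1ₙ * a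
  negate-unique a b a+b≡0 = +-cancelʳ-≡ₙ b (−1ₙ * a) a (begin
    b + a              ≡⟨ +-comm b a ⟩
    a + b              ≈⟨ a+b≡0 ⟩
    0                  ≈⟨ −1ₙ-negates a ⟨
    a + −1ₙ * a        ≡⟨ +-comm a _ ⟩
    −1ₙ * a + a        ∎)
    where open ≡ₙ-Reasoning

  n≡ₙ0 : n ≡ₙ 0
  n≡ₙ0 = ≡k*n⇒≡ₙ0 1 (sym (*-identityˡ n))

  ≡n⇒≡ₙ0 : ∀ {a} → a ≡ n → a ≡ₙ 0
  ≡n⇒≡ₙ0 refl = n≡ₙ0

  k*0≡ₙ0 : ∀ k → k * 0 ≡ₙ 0
  k*0≡ₙ0 k = cong (_% n) (*-zeroʳ k)

  a≡ₙa+k*0 : ∀ a k → a ≡ₙ a + k * 0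
  a≡ₙa+k*0 a k = cong (_% n) (sym (trans (cong (a +_) (*-zeroʳ k)) (+-identityʳ a)))

  −1ₙ*−1ₙ≡ₙ1 : −1ₙ * −1ₙ ≡ₙ 1
  −1ₙ*−1ₙ≡ₙ1 = sym (negate-unique −1ₙ 1 (≡n⇒≡ₙ0 (trans (+-comm −1ₙ 1) 1+−1ₙ)))

  -- Affine maps of Z_n

  aff : ℕ → ℕ → Fin n → Fin n
  aff e c x = (c + e * toℕ x) mod n

  aff-cong : ∀ {e e′ c c′} → e ≡ₙ e′ → c ≡ₙ c′ → aff e c ≗ aff e′ c′
  aff-cong e≡e′ c≡c′ x = mod-congₙ (+-congₙ c≡c′ (*-congₙ e≡e′ refl))

  aff-congʳ : ∀ e {c c′} → c ≡ₙ c′ → aff e c ≗ aff e c′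
  aff-congʳ e = aff-cong {e} refl

  aff-∘ : ∀ e c e′ c′ → aff e c ∘ aff e′ c′ ≗ aff (e * e′) (c + e * c′)
  aff-∘ e c e′ c′ x = mod-congₙ (begin
    c + e * toℕ (aff e′ c′ x)     ≈⟨ +-congₙ {c} refl (*-congₙ {e} refl (toℕ-modₙ _)) ⟩
    c + e * (c′ + e′ * toℕ x)     ≡⟨ expand c e c′ e′ (toℕ x) ⟩
    c + e * c′ + e * e′ * toℕ x   ∎)
    where
    open ≡ₙ-Reasoning
    expand : ∀ c e c′ e′ x → c + e * (c′ + e′ * x) ≡ c + e * c′ + e * e′ * x
    expand = solve-∀

  aff-id : aff 1 0 ≗ id
  aff-id x = toℕ-injective (trans (toℕ-fromℕ< _) (trans (cong (_% n) (+-identityʳ (toℕ x))) (m<n⇒m%n≡m (toℕ<n x))))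

  subtract : ℕ → Fin n → Fin n
  subtract a = aff 1 (−1ₙ * a)

  reflect : ℕ → Fin n → Fin n
  reflect c = aff −1ₙ c

  subtract-cong : ∀ {a b} → a ≡ₙ b → subtract a ≗ subtract b
  subtract-cong a≡b = aff-congʳ 1 (*-congₙ {−1ₙ} refl a≡b)

  subtract-zero : ∀ {a} → a ≡ₙ 0 → subtract a ≗ id
  subtract-zero a≡0 x = trans (aff-congʳ 1 (trans (*-congₙ {−1ₙ} refl a≡0) (k*0≡ₙ0 −1ₙ)) x) (aff-id x)

  subtract-∘ : ∀ a b → subtract a ∘ subtract b ≗ subtract (a + b)
  subtract-∘ a b x = trans (aff-∘ 1 (−1ₙ * a) 1 (−1ₙ * b) x)
    (aff-congʳ 1 (cong (_% n) (trans (cong (−1ₙ * a +_) (*-identityˡ _)) (sym (*-distribˡ-+ −1ₙ a b)))) x)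

  reflect-∘-subtract : ∀ c a → reflect c ∘ subtract a ≗ reflect (c + a)
  reflect-∘-subtract c a x = trans (aff-∘ −1ₙ c 1 (−1ₙ * a) x) (aff-cong (cong (_% n) (*-identityʳ −1ₙ)) (begin
    c + −1ₙ * (−1ₙ * a)   ≡⟨ cong (c +_) (*-assoc −1ₙ −1ₙ a) ⟨
    c + −1ₙ * −1ₙ * a     ≈⟨ +-congₙ {c} refl (*-congₙ −1ₙ*−1ₙ≡ₙ1 refl) ⟩
    c + 1 * a             ≡⟨ cong (c +_) (*-identityˡ a) ⟩
    c + a                 ∎) x)
    where open ≡ₙ-Reasoning

  reflect-conjugate : ∀ c a b → a + b ≡ₙ 0 → reflect c ∘ subtract a ≗ subtract b ∘ reflect c
  reflect-conjugate c a b a+b≡0 x = begin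
    reflect c (subtract a x)           ≡⟨ reflect-∘-subtract c a x ⟩
    reflect (c + a) x                  ≡⟨ aff-cong (cong (_% n) (sym (*-identityˡ −1ₙ))) c+a≡ x ⟩
    aff (1 * −1ₙ) (−1ₙ * b + 1 * c) x  ≡⟨ aff-∘ 1 (−1ₙ * b) −1ₙ c x ⟨
    subtract b (reflect c x)           ∎
    where
    open ≡-Reasoning
    c+a≡ : c + a ≡ₙ −1ₙ * b + 1 * c
    c+a≡ = trans (+-congₙ {c} refl (trans (negate-unique b a (trans (cong (_% n) (+-comm b a)) a+b≡0)) refl))
                 (cong (_% n) (trans (+-comm c _) (cong (−1ₙ * b +_) (sym (*-identityˡ c)))))

  reflect-involutive : ∀ c → reflect c ∘ reflect c ≗ id
  reflect-involutive c x = trans (aff-∘ −1ₙ c −1ₙ c x) (trans (aff-cong −1ₙ*−1ₙ≡ₙ1 (−1ₙ-negates c) x) (aff-id x))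

  ⊕-aff : ∀ x y → x ⊕ y ≡ aff 1 (toℕ y) x
  ⊕-aff x y = cong (_mod n) (trans (+-comm (toℕ x) (toℕ y)) (cong (toℕ y +_) (sym (*-identityˡ (toℕ x)))))

  ⊖-subtract : ∀ x y → x ⊖ y ≡ subtract (toℕ y) x
  ⊖-subtract x y = mod-congₙ (begin
    toℕ x + (n ∸ toℕ y)         ≡⟨ +-comm (toℕ x) _ ⟩
    (n ∸ toℕ y) + toℕ x         ≈⟨ +-congₙ n∸y≡ₙ (cong (_% n) (sym (*-identityˡ (toℕ x)))) ⟩
    −1ₙ * toℕ y + 1 * toℕ x     ∎)
    where
    open ≡ₙ-Reasoning
    n∸y≡ₙ : n ∸ toℕ y ≡ₙ −1ₙ * toℕ y
    n∸y≡ₙ = negate-unique (toℕ y) _ (≡n⇒≡ₙ0 (m+[n∸m]≡n (<⇒≤ (toℕ<n y))))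

  translations-cancel : ∀ a b → a + b ≡ₙ 0 → aff 1 a ∘ aff 1 b ≗ id
  translations-cancel a b a+b≡0 x = trans (aff-∘ 1 a 1 b x)
    (trans (aff-congʳ 1 (trans (cong (λ z → (a + z) % n) (*-identityˡ b)) a+b≡0) x) (aff-id x))

  ⊖-⊕-cancel : ∀ x y → (x ⊖ y) ⊕ y ≡ x
  ⊖-⊕-cancel x y = trans (⊕-aff (x ⊖ y) y)
    (trans (cong (aff 1 (toℕ y)) (⊖-subtract x y)) (translations-cancel (toℕ y) _ (−1ₙ-negates (toℕ y)) x))

  ⊕-⊖-cancel : ∀ x y → (x ⊕ y) ⊖ y ≡ x
  ⊕-⊖-cancel x y = trans (⊖-subtract (x ⊕ y) y)
    (trans (cong (subtract (toℕ y)) (⊕-aff x y))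
           (translations-cancel _ (toℕ y) (trans (cong (_% n) (+-comm (−1ₙ * toℕ y) (toℕ y))) (−1ₙ-negates (toℕ y))) x))

  flipZ-reflect : ∀ x → flipZ x ≡ reflect −1ₙ x
  flipZ-reflect x = mod-congₙ (+-cancelʳ-≡ₙ _ _ (toℕ x) (begin
    n ∸ 1 ∸ toℕ x + toℕ x            ≡⟨ m∸n+n≡m (toℕ≤pred[n] x) ⟩
    −1ₙ                               ≡⟨ +-identityʳ −1ₙ ⟨
    −1ₙ + 0                           ≈⟨ +-congₙ {−1ₙ} refl (−1ₙ-negates (toℕ x)) ⟨
    −1ₙ + (toℕ x + −1ₙ * toℕ x)       ≡⟨ regroup −1ₙ (toℕ x) ⟩
    −1ₙ + −1ₙ * toℕ x + toℕ x         ∎))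
    where
    open ≡ₙ-Reasoning
    regroup : ∀ m x → m + (x + m * x) ≡ m + m * x + x
    regroup = solve-∀

  flipZ-involutive : ∀ x → flipZ (flipZ x) ≡ x
  flipZ-involutive x = trans (flipZ-reflect _) (trans (cong (reflect −1ₙ) (flipZ-reflect x)) (reflect-involutive −1ₙ x))

  -- Cell permutations of words

  Endo : Set
  Endo = Cell n → Cell n

  _⊗_ : (Fin n → Fin n) → (Fin n → Fin n) → Cell n → Cell n
  φ ⊗ ψ = Product.map φ ψ

  posL : Letter → Endo
  posL r   (i , j) = flipZ j , i
  posL s   (i , j) = i , flipZ j
  posL τ₁  (i , j) = i ⊖ oneZ , j
  posL τ₂  (i , j) = i , j ⊖ oneZ
  posL r⁻  (i , j) = j , flipZ i
  posL s⁻  (i , j) = i , flipZ j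
  posL τ₁⁻ (i , j) = i ⊕ oneZ , j
  posL τ₂⁻ (i , j) = i , j ⊕ oneZ

  pos : Word → Endo
  pos []      = id
  pos (l ∷ w) = pos w ∘ posL l

  infixl 5 _∙_
  _∙_ : Arr n → Endo → Arr n
  (A ∙ π) i j = uncurry A (π (i , j))

  actL-posL : ∀ l A i j → actL l A i j ≡ (A ∙ posL l) i j
  actL-posL r   A i j = refl
  actL-posL s   A i j = refl
  actL-posL τ₁  A i j = refl
  actL-posL τ₂  A i j = refl
  actL-posL r⁻  A i j = refl
  actL-posL s⁻  A i j = refl
  actL-posL τ₁⁻ A i j = refl
  actL-posL τ₂⁻ A i j = refl

  act-pos : ∀ w A i j → act w A i j ≡ (A ∙ pos w) i j
  act-pos []      A i j = refl
  act-pos (l ∷ w) A i j = trans (actL-posL l (act w A) i j) (act-pos w A _ _)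

  pos-++ : ∀ w v → pos (w ++ v) ≗ pos v ∘ pos w
  pos-++ []      v c = refl
  pos-++ (l ∷ w) v c = pos-++ w v (posL l c)

  posL-invL : ∀ l → posL (invL l) ∘ posL l ≗ id
  posL-invL r   (i , j) = cong (i ,_) (flipZ-involutive j)
  posL-invL s   (i , j) = cong (i ,_) (flipZ-involutive j)
  posL-invL τ₁  (i , j) = cong (_, j) (⊖-⊕-cancel i oneZ)
  posL-invL τ₂  (i , j) = cong (i ,_) (⊖-⊕-cancel j oneZ)
  posL-invL r⁻  (i , j) = cong (_, j) (flipZ-involutive i)
  posL-invL s⁻  (i , j) = cong (i ,_) (flipZ-involutive j)
  posL-invL τ₁⁻ (i , j) = cong (_, j) (⊕-⊖-cancel i oneZ)
  posL-invL τ₂⁻ (i , j) = cong (i ,_) (⊕-⊖-cancel j oneZ)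

  pos-invW : ∀ w → pos (invW w) ∘ pos w ≗ id
  pos-invW []      c = refl
  pos-invW (l ∷ w) c = begin
    pos (invW (l ∷ w)) (pos w (posL l c))            ≡⟨ cong (λ v → pos v (pos w (posL l c))) (unfold-reverse (invL l) (List.map invL w)) ⟩
    pos (invW w ++ [ invL l ]) (pos w (posL l c))    ≡⟨ pos-++ (invW w) [ invL l ] _ ⟩
    posL (invL l) (pos (invW w) (pos w (posL l c)))  ≡⟨ cong (posL (invL l)) (pos-invW w (posL l c)) ⟩
    posL (invL l) (posL l c)                         ≡⟨ posL-invL l c ⟩
    c                                                ∎
    where open ≡-Reasoning

  ^-suc : ∀ (h : Endo) k → h ^ suc k ≗ (h ^ k) ∘ h
  ^-suc h k c = trans (cong (λ j → (h ^ j) c) (+-comm 1 k)) (cong-app (^-homo h k 1) c)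

  ^-cong : ∀ {f g : Endo} → f ≗ g → ∀ k → f ^ k ≗ g ^ k
  ^-cong f≗g zero    c = refl
  ^-cong {f} {g} f≗g (suc k) c = trans (f≗g _) (cong g (^-cong f≗g k c))

  ^-+ : ∀ (h : Endo) a b → h ^ (a + b) ≗ (h ^ a) ∘ (h ^ b)
  ^-+ h a b = cong-app (^-homo h a b)

  ^-comm : ∀ (h : Endo) a b → (h ^ a) ∘ (h ^ b) ≗ (h ^ b) ∘ (h ^ a)
  ^-comm h a b c = trans (sym (^-+ h a b c)) (trans (cong (λ j → (h ^ j) c) (+-comm a b)) (^-+ h b a c))

  ^-order : ∀ {h : Endo} {q} → h ^ q ≗ id → ∀ k → h ^ (k * q) ≗ id
  ^-order h^q≗id zero    c = refl
  ^-order {h} {q} h^q≗id (suc k) c = trans (^-+ h q (k * q) c) (trans (h^q≗id _) (^-order h^q≗id k c))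

  ^-inverse : ∀ {h : Endo} {p} → h ^ suc p ≗ id → ∀ j → (h ^ j) ∘ (h ^ (p * j)) ≗ id
  ^-inverse {h} {p} h^q≗id j c = trans (sym (^-+ h j (p * j) c))
    (trans (cong (λ k → (h ^ k) c) (*-comm (suc p) j)) (^-order h^q≗id j c))

  pos-^^ : ∀ w k → pos (w ^^ k) ≗ pos w ^ k
  pos-^^ w zero    c = refl
  pos-^^ w (suc k) c = trans (pos-++ w (w ^^ k) c) (trans (pos-^^ w k (pos w c)) (sym (^-suc (pos w) k c)))

  shift : ℕ → ℕ → Endo
  shift a b = subtract a ⊗ subtract b

  shift-cong : ∀ {a a′ b b′} → a ≡ₙ a′ → b ≡ₙ b′ → shift a b ≗ shift a′ b′
  shift-cong a≡a′ b≡b′ (i , j) = cong₂ _,_ (subtract-cong a≡a′ i) (subtract-cong b≡b′ j)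

  shift-zero : ∀ {a b} → a ≡ₙ 0 → b ≡ₙ 0 → shift a b ≗ id
  shift-zero a≡0 b≡0 (i , j) = cong₂ _,_ (subtract-zero a≡0 i) (subtract-zero b≡0 j)

  shift-∘ : ∀ a b c d → shift a b ∘ shift c d ≗ shift (a + c) (b + d)
  shift-∘ a b c d (i , j) = cong₂ _,_ (subtract-∘ a c i) (subtract-∘ b d j)

  shift-^ : ∀ a b k → shift a b ^ k ≗ shift (k * a) (k * b)
  shift-^ a b zero    c = sym (shift-zero refl refl c)
  shift-^ a b (suc k) c = trans (cong (shift a b) (shift-^ a b k c)) (shift-∘ a b (k * a) (k * b) c)

  shift-^-id : ∀ {a b} k → k * a ≡ₙ 0 → k * b ≡ₙ 0 → shift a b ^ k ≗ id
  shift-^-id {a} {b} k ka≡0 kb≡0 c = trans (shift-^ a b k c) (shift-zero ka≡0 kb≡0 c)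

  shift-order : ∀ a b → shift a b ^ n ≗ id
  shift-order a b = shift-^-id n (≡k*n⇒≡ₙ0 a (*-comm n a)) (≡k*n⇒≡ₙ0 b (*-comm n b))

  shift-comm : ∀ a b c d → shift a b ∘ shift c d ≗ shift c d ∘ shift a b
  shift-comm a b c d x = trans (shift-∘ a b c d x)
    (trans (shift-cong (cong (_% n) (+-comm a c)) (cong (_% n) (+-comm b d)) x) (sym (shift-∘ c d a b x)))

  ⊗-conjugate : ∀ {φ ψ a a′ b b′} → φ ∘ subtract a ≗ subtract a′ ∘ φ → ψ ∘ subtract b ≗ subtract b′ ∘ ψ →
                (φ ⊗ ψ) ∘ shift a b ≗ shift a′ b′ ∘ (φ ⊗ ψ)
  ⊗-conjugate φ-conj ψ-conj (i , j) = cong₂ _,_ (φ-conj i) (ψ-conj j)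

  conjugate-via : ∀ {g π ρ σ : Endo} → ρ ≗ σ → g ∘ π ≗ σ ∘ g → g ∘ π ≗ ρ ∘ g
  conjugate-via ρ≗σ conj c = trans (conj c) (sym (ρ≗σ _))

  ⊗-involutive : ∀ {φ ψ} → φ ∘ φ ≗ id → ψ ∘ ψ ≗ id → (φ ⊗ ψ) ^ 2 ≗ id
  ⊗-involutive φ² ψ² (i , j) = cong₂ _,_ (φ² i) (ψ² j)

  pos-τ₁ : ∀ a → pos (τ^ τ₁ a) ≗ shift a 0
  pos-τ₁ a c = begin
    pos (τ^ τ₁ a) c            ≡⟨ pos-^^ (τ₁ ∷ []) a c ⟩
    (posL τ₁ ^ a) c            ≡⟨ ^-cong posL-τ₁ a c ⟩
    (shift 1 0 ^ a) c          ≡⟨ shift-^ 1 0 a c ⟩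
    shift (a * 1) (a * 0) c    ≡⟨ shift-cong (cong (_% n) (*-identityʳ a)) (k*0≡ₙ0 a) c ⟩
    shift a 0 c                ∎
    where
    open ≡-Reasoning
    posL-τ₁ : posL τ₁ ≗ shift 1 0
    posL-τ₁ (i , j) = cong₂ _,_ (trans (⊖-subtract i oneZ) (subtract-cong (toℕ-modₙ 1) i)) (sym (subtract-zero refl j))

  pos-τ₂ : ∀ b → pos (τ^ τ₂ b) ≗ shift 0 b
  pos-τ₂ b c = begin
    pos (τ^ τ₂ b) c            ≡⟨ pos-^^ (τ₂ ∷ []) b c ⟩
    (posL τ₂ ^ b) c            ≡⟨ ^-cong posL-τ₂ b c ⟩
    (shift 0 1 ^ b) c          ≡⟨ shift-^ 0 1 b c ⟩
    shift (b * 0) (b * 1) c    ≡⟨ shift-cong (k*0≡ₙ0 b) (cong (_% n) (*-identityʳ b)) c ⟩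
    shift 0 b c                ∎
    where
    open ≡-Reasoning
    posL-τ₂ : posL τ₂ ≗ shift 0 1
    posL-τ₂ (i , j) = cong₂ _,_ (sym (subtract-zero refl i)) (trans (⊖-subtract j oneZ) (subtract-cong (toℕ-modₙ 1) j))

  pos-τ₁τ₂ : ∀ a b → pos (τ^ τ₁ a ++ τ^ τ₂ b) ≗ shift a b
  pos-τ₁τ₂ a b c = begin
    pos (τ^ τ₁ a ++ τ^ τ₂ b) c                 ≡⟨ pos-++ (τ^ τ₁ a) (τ^ τ₂ b) c ⟩
    pos (τ^ τ₂ b) (pos (τ^ τ₁ a) c)            ≡⟨ pos-τ₂ b _ ⟩
    shift 0 b (pos (τ^ τ₁ a) c)                ≡⟨ cong (shift 0 b) (pos-τ₁ a c) ⟩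
    shift 0 b (shift a 0 c)                    ≡⟨ shift-∘ 0 b a 0 c ⟩
    shift a (b + 0) c                          ≡⟨ cong (λ d → shift a d c) (+-identityʳ b) ⟩
    shift a b c                                ∎
    where open ≡-Reasoning

  pos-τ₁τ₂-++ : ∀ a b w → pos (τ^ τ₁ a ++ τ^ τ₂ b ++ w) ≗ pos w ∘ shift a b
  pos-τ₁τ₂-++ a b w c = begin
    pos (τ^ τ₁ a ++ τ^ τ₂ b ++ w) c       ≡⟨ cong (λ v → pos v c) (++-assoc (τ^ τ₁ a) (τ^ τ₂ b) w) ⟨
    pos ((τ^ τ₁ a ++ τ^ τ₂ b) ++ w) c     ≡⟨ pos-++ (τ^ τ₁ a ++ τ^ τ₂ b) w c ⟩
    pos w (pos (τ^ τ₁ a ++ τ^ τ₂ b) c)    ≡⟨ cong (pos w) (pos-τ₁τ₂ a b c) ⟩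
    pos w (shift a b c)                   ∎
    where open ≡-Reasoning

  pos-τ₂-s : ∀ b → pos (τ^ τ₂ b ++ s ∷ []) ≗ id ⊗ reflect (−1ₙ + b)
  pos-τ₂-s b c = trans (pos-τ₁τ₂-++ 0 b (s ∷ []) c)
    (cong₂ _,_ (subtract-zero refl (proj₁ c)) (trans (flipZ-reflect _) (reflect-∘-subtract −1ₙ b (proj₂ c))))

  pos-τ₁τ₂-r² : ∀ a b → pos (τ^ τ₁ a ++ τ^ τ₂ b ++ r ∷ r ∷ []) ≗ reflect (−1ₙ + a) ⊗ reflect (−1ₙ + b)
  pos-τ₁τ₂-r² a b c = trans (pos-τ₁τ₂-++ a b (r ∷ r ∷ []) c)
    (cong₂ _,_ (trans (flipZ-reflect _) (reflect-∘-subtract −1ₙ a (proj₁ c)))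
               (trans (flipZ-reflect _) (reflect-∘-subtract −1ₙ b (proj₂ c))))

  -- Relabelling

  infix 4 _∼_
  _∼_ : Arr n → Arr n → Set
  _∼_ = Relabel

  ∼-reflexive : ∀ {A B} → (∀ i j → A i j ≡ B i j) → A ∼ B
  ∼-reflexive A≡B = Perm.id , A≡B

  ∼-refl : ∀ {A} → A ∼ A
  ∼-refl = ∼-reflexive (λ _ _ → refl)

  ∼-sym : ∀ {A B} → A ∼ B → B ∼ A
  ∼-sym (σ , σA≡B) = Perm.flip σ , λ i j → trans (cong (Perm.flip σ ⟨$⟩ʳ_) (sym (σA≡B i j))) (inverseˡ σ)

  ∼-trans : ∀ {A B C} → A ∼ B → B ∼ C → A ∼ C
  ∼-trans (σ , σA≡B) (ρ , ρB≡C) = σ ∘ₚ ρ , λ i j → trans (cong (ρ ⟨$⟩ʳ_) (σA≡B i j)) (ρB≡C i j)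

  ∼-setoid : Setoid 0ℓ 0ℓ
  ∼-setoid = record
    { Carrier = Arr n ; _≈_ = _∼_
    ; isEquivalence = record { refl = ∼-refl ; sym = ∼-sym ; trans = ∼-trans } }

  ∙-congˡ : ∀ {A B} π → A ∼ B → A ∙ π ∼ B ∙ π
  ∙-congˡ π (σ , σA≡B) = σ , λ i j → σA≡B _ _

  ∙-congʳ : ∀ A {π ρ} → π ≗ ρ → A ∙ π ∼ A ∙ ρ
  ∙-congʳ A π≗ρ = ∼-reflexive λ i j → cong (uncurry A) (π≗ρ (i , j))

  act-∼ : ∀ w A → act w A ∼ A ∙ pos w
  act-∼ w A = ∼-reflexive (act-pos w A)

  ∙-cancelʳ : ∀ {A B π ρ} → π ∘ ρ ≗ id → A ∙ π ∼ B ∙ π → A ∼ B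
  ∙-cancelʳ {A} {B} {π} {ρ} π∘ρ≗id Aπ∼Bπ = begin
    A              ≈⟨ ∙-congʳ A π∘ρ≗id ⟨
    A ∙ π ∙ ρ      ≈⟨ ∙-congˡ ρ Aπ∼Bπ ⟩
    B ∙ π ∙ ρ      ≈⟨ ∙-congʳ B π∘ρ≗id ⟩
    B              ∎
    where open SetoidReasoning ∼-setoid

  Onto : Arr n → Set
  Onto A = ∀ k → ∃ λ c → uncurry A c ≡ k

  latin-onto : ∀ {A} → Latin A → Onto A
  latin-onto (rows , _) k = (k , proj₁ (rows k k)) , proj₁ (proj₂ (rows k k))

  onto-∼ : ∀ {A B} → Onto A → A ∼ B → Onto B
  onto-∼ A-onto (σ , σA≡B) k = let (c , A[c]≡σ⁻¹k) = A-onto (σ ⟨$⟩ˡ k) in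
    c , trans (sym (σA≡B _ _)) (trans (cong (σ ⟨$⟩ʳ_) A[c]≡σ⁻¹k) (inverseʳ σ))

  onto-∙ : ∀ {A π ρ} → Onto A → π ∘ ρ ≗ id → Onto (A ∙ π)
  onto-∙ {A} {π} {ρ} A-onto π∘ρ≗id k = let (c , A[c]≡k) = A-onto k in
    ρ c , trans (cong (uncurry A) (π∘ρ≗id c)) A[c]≡k

  -- A relabelling of A into B must send k to the entry of B wherever A shows k,
  -- so whether A ∼ B holds is decided by testing this one candidate.
  candidate : ∀ {A} → Onto A → Arr n → Fin n → Fin n
  candidate A-onto B k = uncurry B (proj₁ (A-onto k))

  candidate-forced : ∀ {A B} (A-onto : Onto A) ((σ , _) : A ∼ B) → ∀ k → candidate A-onto B k ≡ σ ⟨$⟩ʳ k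
  candidate-forced A-onto (σ , σA≡B) k = trans (sym (σA≡B _ _)) (cong (σ ⟨$⟩ʳ_) (proj₂ (A-onto k)))

  ∼-dec : ∀ {A B} → Onto A → Onto B → Dec (A ∼ B)
  ∼-dec {A} {B} A-onto B-onto
    with all? (λ i → all? λ j → candidate A-onto B (A i j) ≟ B i j)
       | all? (λ i → all? λ j → candidate B-onto A (B i j) ≟ A i j)
  ... | yes fits | yes fits⁻¹ = yes (permutation (candidate A-onto B) (candidate B-onto A)
          (λ k → trans (fits _ _) (proj₂ (B-onto k))) (λ k → trans (fits⁻¹ _ _) (proj₂ (A-onto k))) , fits)
  ... | no ¬fits | _ = no λ A∼B → ¬fits λ i j → trans (candidate-forced A-onto A∼B (A i j)) (proj₂ A∼B i j)
  ... | yes _ | no ¬fits⁻¹ = no λ A∼B → ¬fits⁻¹ λ i j →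
          trans (candidate-forced B-onto (∼-sym A∼B) (B i j)) (proj₂ (∼-sym A∼B) i j)

  -- Subgroups and polycyclic series

  record IsSubgroup (K : Endo → Set) : Set where
    field
      ∈-resp  : ∀ {π ρ} → π ≗ ρ → K π → K ρ
      id-∈    : K id
      ∘-∈     : ∀ {π ρ} → K π → K ρ → K (π ∘ ρ)
      inverse : ∀ {π} → K π → ∃ λ ρ → K ρ × π ∘ ρ ≗ id

    ^-∈ : ∀ {π} → K π → ∀ k → K (π ^ k)
    ^-∈ Kπ zero    = id-∈
    ^-∈ Kπ (suc k) = ∘-∈ Kπ (^-∈ Kπ k)

  ConjugatesInto : Endo → (Endo → Set) → (Endo → Set) → Set
  ConjugatesInto h K K′ = ∀ {κ} → K κ → ∃ λ κ′ → K′ κ′ × h ∘ κ ≗ κ′ ∘ h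

  Normalizes : Endo → (Endo → Set) → Set
  Normalizes h K = ConjugatesInto h K K

  normalizes-^ : ∀ {h K} → Normalizes h K → ∀ j → Normalizes (h ^ j) K
  normalizes-^ h-norm zero    Kκ = _ , Kκ , λ c → refl
  normalizes-^ {h} h-norm (suc j) Kκ =
    let (κ₁ , Kκ₁ , hʲκ≗κ₁hʲ) = normalizes-^ h-norm j Kκ
        (κ₂ , Kκ₂ , hκ₁≗κ₂h)  = h-norm Kκ₁
    in κ₂ , Kκ₂ , λ c → trans (cong h (hʲκ≗κ₁hʲ c)) (hκ₁≗κ₂h _)

  -- Since h ^ (p * j) inverts h ^ j, conjugating by it moves K past h ^ j the other way.
  normalizesʳ : ∀ {h K p} → Normalizes h K → h ^ suc p ≗ id →
                ∀ j {κ} → K κ → ∃ λ κ′ → K κ′ × κ ∘ (h ^ j) ≗ (h ^ j) ∘ κ′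
  normalizesʳ {h} {p = p} h-norm h-order j {κ} Kκ =
    let (κ′ , Kκ′ , conj) = normalizes-^ h-norm (p * j) Kκ in
    κ′ , Kκ′ , λ c → begin
      κ ((h ^ j) c)                                      ≡⟨ ^-inverse {p = p} h-order j _ ⟨
      (h ^ j) ((h ^ (p * j)) (κ ((h ^ j) c)))            ≡⟨ cong (h ^ j) (conj _) ⟩
      (h ^ j) (κ′ ((h ^ (p * j)) ((h ^ j) c)))           ≡⟨ cong ((h ^ j) ∘ κ′) (^-comm h (p * j) j c) ⟩
      (h ^ j) (κ′ ((h ^ j) ((h ^ (p * j)) c)))           ≡⟨ cong ((h ^ j) ∘ κ′) (^-inverse {p = p} h-order j c) ⟩
      (h ^ j) (κ′ c)                                     ∎
    where open ≡-Reasoning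

  infixl 5 _⟨_⟩
  _⟨_⟩ : (Endo → Set) → Endo → Endo → Set
  (K ⟨ h ⟩) π = ∃₂ λ j κ → K κ × π ≗ κ ∘ (h ^ j)

  ⊆-⟨⟩ : ∀ {K h κ} → K κ → (K ⟨ h ⟩) κ
  ⊆-⟨⟩ Kκ = 0 , _ , Kκ , λ c → refl

  ⟨⟩-subgroup : ∀ {K h p} → IsSubgroup K → Normalizes h K → h ^ suc p ≗ id → IsSubgroup (K ⟨ h ⟩)
  ⟨⟩-subgroup {K} {h} {p} K-sub h-norm h-order = record
    { ∈-resp  = λ { π≗ρ (j , κ , Kκ , π≗κhʲ) → j , κ , Kκ , λ c → trans (sym (π≗ρ c)) (π≗κhʲ c) }
    ; id-∈    = ⊆-⟨⟩ id-∈
    ; ∘-∈     = compose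
    ; inverse = invert
    }
    where
    open IsSubgroup K-sub
    compose : ∀ {π ρ} → (K ⟨ h ⟩) π → (K ⟨ h ⟩) ρ → (K ⟨ h ⟩) (π ∘ ρ)
    compose {π} {ρ} (a , κ₁ , Kκ₁ , π≗) (b , κ₂ , Kκ₂ , ρ≗) =
      let (κ₂′ , Kκ₂′ , conj) = normalizes-^ h-norm a Kκ₂ in
      a + b , κ₁ ∘ κ₂′ , ∘-∈ Kκ₁ Kκ₂′ , λ c → begin
        π (ρ c)                           ≡⟨ π≗ (ρ c) ⟩
        κ₁ ((h ^ a) (ρ c))                ≡⟨ cong (κ₁ ∘ (h ^ a)) (ρ≗ c) ⟩
        κ₁ ((h ^ a) (κ₂ ((h ^ b) c)))     ≡⟨ cong κ₁ (conj _) ⟩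
        κ₁ (κ₂′ ((h ^ a) ((h ^ b) c)))    ≡⟨ cong (κ₁ ∘ κ₂′) (^-+ h a b c) ⟨
        κ₁ (κ₂′ ((h ^ (a + b)) c))        ∎
      where open ≡-Reasoning
    invert : ∀ {π} → (K ⟨ h ⟩) π → ∃ λ ρ → (K ⟨ h ⟩) ρ × π ∘ ρ ≗ id
    invert {π} (j , κ , Kκ , π≗) =
      let (κ⁻¹ , Kκ⁻¹ , κκ⁻¹≗id) = inverse Kκ
          (κ′ , Kκ′ , conj)     = normalizes-^ h-norm (p * j) Kκ⁻¹
      in (h ^ (p * j)) ∘ κ⁻¹ , (p * j , κ′ , Kκ′ , conj) , λ c → begin
        π ((h ^ (p * j)) (κ⁻¹ c))                 ≡⟨ π≗ _ ⟩
        κ ((h ^ j) ((h ^ (p * j)) (κ⁻¹ c)))       ≡⟨ cong κ (^-inverse {p = p} h-order j _) ⟩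
        κ (κ⁻¹ c)                                 ≡⟨ κκ⁻¹≗id c ⟩
        c                                         ∎
      where open ≡-Reasoning

  conjugates-^ : ∀ {g h ρ : Endo} → g ∘ h ≗ ρ ∘ g → ∀ j → g ∘ (h ^ j) ≗ (ρ ^ j) ∘ g
  conjugates-^ gh≗ρg zero    c = refl
  conjugates-^ {g} {h} {ρ} gh≗ρg (suc j) c = trans (gh≗ρg _) (cong ρ (conjugates-^ gh≗ρg j c))

  conjugates-⟨⟩ : ∀ {g h K K′} → IsSubgroup K′ → ConjugatesInto g K K′ →
                  (∃ λ ρ → K′ ρ × g ∘ h ≗ ρ ∘ g) → ConjugatesInto g (K ⟨ h ⟩) K′
  conjugates-⟨⟩ {g} {h} K′-sub g-conj (ρ , K′ρ , gh≗ρg) {π} (j , κ , Kκ , π≗) =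
    let (κ′ , K′κ′ , gκ≗κ′g) = g-conj Kκ in
    κ′ ∘ (ρ ^ j) , ∘-∈ K′κ′ (^-∈ K′ρ j) , λ c → begin
      g (π c)                     ≡⟨ cong g (π≗ c) ⟩
      g (κ ((h ^ j) c))           ≡⟨ gκ≗κ′g _ ⟩
      κ′ (g ((h ^ j) c))          ≡⟨ cong κ′ (conjugates-^ gh≗ρg j c) ⟩
      κ′ ((ρ ^ j) (g c))          ∎
    where
    open IsSubgroup K′-sub
    open ≡-Reasoning

  Generated : List Endo → Endo → Set
  Generated []       π = π ≗ id
  Generated (h ∷ hs)   = Generated hs ⟨ h ⟩

  id-generated : ∀ hs → Generated hs id
  id-generated []       c = refl
  id-generated (h ∷ hs)   = ⊆-⟨⟩ (id-generated hs)

  generator-generated : ∀ {h hs} → h ∈ hs → Generated hs h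
  generator-generated {hs = h ∷ hs} (here refl) = 1 , id , id-generated hs , λ c → refl
  generator-generated (there h∈hs) = ⊆-⟨⟩ (generator-generated h∈hs)

  trivial-subgroup : IsSubgroup (Generated [])
  trivial-subgroup = record
    { ∈-resp  = λ π≗ρ π≗id c → trans (sym (π≗ρ c)) (π≗id c)
    ; id-∈    = λ c → refl
    ; ∘-∈     = λ {π} π≗id ρ≗id c → trans (cong π (ρ≗id c)) (π≗id c)
    ; inverse = λ π≗id → id , (λ c → refl) , π≗id
    }

  conjugates-generated : ∀ {g K′} hs → IsSubgroup K′ →
    All (λ h → ∃ λ ρ → K′ ρ × g ∘ h ≗ ρ ∘ g) hs → ConjugatesInto g (Generated hs) K′
  conjugates-generated {g} [] K′-sub [] κ≗id = id , IsSubgroup.id-∈ K′-sub , λ c → cong g (κ≗id c)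
  conjugates-generated (h ∷ hs) K′-sub (gh≗ρg ∷ conj) =
    conjugates-⟨⟩ K′-sub (conjugates-generated hs K′-sub conj) gh≗ρg

  -- PolycyclicSeries hs q: each h in hs has order dividing its p + 1 and conjugates the
  -- elements after it into the group they generate, so the order of Generated hs divides q.
  data PolycyclicSeries : List Endo → ℕ → Set where
    trivial : PolycyclicSeries [] 1
    extend  : ∀ {hs q} h p → PolycyclicSeries hs q → h ^ suc p ≗ id →
              All (λ g → ∃ λ ρ → Generated hs ρ × h ∘ g ≗ ρ ∘ h) hs →
              PolycyclicSeries (h ∷ hs) (suc p * q)

  series-subgroup : ∀ {hs q} → PolycyclicSeries hs q → IsSubgroup (Generated hs)
  series-subgroup trivial = trivial-subgroup
  series-subgroup (extend {hs} h p series h-order conj) =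
    ⟨⟩-subgroup {p = p} (series-subgroup series) (conjugates-generated hs (series-subgroup series) conj) h-order

  -- Orbits of relabelling classes

  module _ (S : Arr n) (S-onto : Onto S) where

    record Orbit (K : Endo → Set) (m : ℕ) : Set where
      field
        rep           : Fin m → Arr n
        rep-∈         : ∀ k → ∃ λ κ → K κ × S ∙ κ ∼ rep k
        rep-injective : ∀ k l → rep k ∼ rep l → k ≡ l
        rep-complete  : ∀ {π} → K π → ∃ λ k → S ∙ π ∼ rep k

    trivial-orbit : Orbit (Generated []) 1
    trivial-orbit = record
      { rep           = λ _ → S
      ; rep-∈         = λ _ → id , (λ c → refl) , ∼-refl
      ; rep-injective = λ { zero zero _ → refl }
      ; rep-complete  = λ π≗id → zero , ∙-congʳ S π≗id
      }

    module Extension {K h p m} (K-sub : IsSubgroup K) (h-norm : Normalizes h K)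
                     (h-order : h ^ suc p ≗ id) (orbit : Orbit K m) where
      open IsSubgroup K-sub
      open Orbit orbit

      InOrbit : Arr n → Set
      InOrbit A = ∃ λ k → A ∼ rep k

      inOrbit-resp : ∀ {A B} → A ∼ B → InOrbit B → InOrbit A
      inOrbit-resp A∼B (k , B∼rep) = k , ∼-trans A∼B B∼rep

      inOrbit-∙ : ∀ {A κ} → K κ → InOrbit A → InOrbit (A ∙ κ)
      inOrbit-∙ {A} {κ} Kκ (k , A∼rep) =
        let (κₖ , Kκₖ , Sκₖ∼rep) = rep-∈ k
            (k′ , Sκₖκ∼rep′)     = rep-complete (∘-∈ Kκₖ Kκ)
        in k′ , ∼-trans (∙-congˡ κ (∼-trans A∼rep (∼-sym Sκₖ∼rep))) Sκₖκ∼rep′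

      inOrbit-∙⁻¹ : ∀ {A κ} → K κ → InOrbit (A ∙ κ) → InOrbit A
      inOrbit-∙⁻¹ {A} Kκ Aκ∈ =
        let (κ⁻¹ , Kκ⁻¹ , κκ⁻¹≗id) = inverse Kκ in
        inOrbit-resp (∼-sym (∙-congʳ A κκ⁻¹≗id)) (inOrbit-∙ Kκ⁻¹ Aκ∈)

      rep-onto : ∀ k → Onto (rep k)
      rep-onto k =
        let (κ , Kκ , Sκ∼rep) = rep-∈ k
            (κ⁻¹ , _ , κκ⁻¹≗id) = inverse Kκ
        in onto-∼ (onto-∙ S-onto κκ⁻¹≗id) Sκ∼rep

      slide : ∀ A {κ} → K κ → ∀ j → ∃ λ κ′ → K κ′ × A ∙ κ ∙ (h ^ j) ∼ A ∙ (h ^ j) ∙ κ′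
      slide A Kκ j = let (κ′ , Kκ′ , κhʲ≗hʲκ′) = normalizesʳ {p = p} h-norm h-order j Kκ in
        κ′ , Kκ′ , ∙-congʳ A κhʲ≗hʲκ′

      Period : ℕ → Set
      Period j = InOrbit (S ∙ (h ^ j))

      period⇒shifted : ∀ {j} → Period j → ∀ k → InOrbit (rep k ∙ (h ^ j))
      period⇒shifted {j} per k =
        let (κ , Kκ , Sκ∼rep) = rep-∈ k
            (κ′ , Kκ′ , slid) = slide S Kκ j
        in inOrbit-resp (∼-trans (∙-congˡ (h ^ j) (∼-sym Sκ∼rep)) slid) (inOrbit-∙ Kκ′ per)

      shifted⇒period : ∀ {j k} → InOrbit (rep k ∙ (h ^ j)) → Period j
      shifted⇒period {j} {k} shifted∈ =
        let (κ , Kκ , Sκ∼rep) = rep-∈ k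
            (κ′ , Kκ′ , slid) = slide S Kκ j
        in inOrbit-∙⁻¹ Kκ′ (inOrbit-resp (∼-trans (∼-sym slid) (∙-congˡ (h ^ j) Sκ∼rep)) shifted∈)

      period-+ : ∀ {a b} → Period a → Period b → Period (a + b)
      period-+ {a} {b} (k , Shᵃ∼rep) per-b =
        inOrbit-resp (∼-trans (∙-congʳ S (^-+ h a b)) (∙-congˡ (h ^ b) Shᵃ∼rep)) (period⇒shifted {b} per-b k)

      period-∸ : ∀ {a b} → Period (a + b) → Period a → Period b
      period-∸ {a} {b} per-a+b (k , Shᵃ∼rep) = shifted⇒period {b} {k}
        (inOrbit-resp (∼-trans (∙-congˡ (h ^ b) (∼-sym Shᵃ∼rep)) (∼-sym (∙-congʳ S (^-+ h a b)))) per-a+b)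

      period-* : ∀ {e} → Period e → ∀ q → Period (q * e)
      period-* per zero    = rep-complete id-∈
      period-* {e} per (suc q) = period-+ {e} {q * e} per (period-* per q)

      period-order : Period (suc p)
      period-order = rep-complete (∈-resp (λ c → sym (h-order c)) id-∈)

      period? : Decidable Period
      period? j = any? λ k → ∼-dec (onto-∙ S-onto (^-inverse {p = p} h-order j)) (rep-onto k)

      least-period : ∃ λ e′ → Period (suc e′) × (∀ d → d < e′ → ¬ Period (suc d))
      least-period = least (period? ∘ suc) {p} period-order

      e : ℕ
      e = suc (proj₁ least-period)

      period-e : Period e
      period-e = proj₁ (proj₂ least-period)

      period-below-e : ∀ d → d < e → Period d → d ≡ 0
      period-below-e zero    _          _   = refl
      period-below-e (suc d) (s≤s d<e′) per = ⊥-elim (proj₂ (proj₂ least-period) d d<e′ per)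

      e∣order : e ∣ suc p
      e∣order = least-positive-divides e (period-* period-e) (λ {a} {b} → period-∸ {a} {b}) period-below-e period-order

      shifted : Fin e × Fin m → Arr n
      shifted (j , k) = rep k ∙ (h ^ toℕ j)

      shifted-∈ : ∀ x → ∃ λ π → (K ⟨ h ⟩) π × S ∙ π ∼ shifted x
      shifted-∈ (j , k) = let (κ , Kκ , Sκ∼rep) = rep-∈ k in
        κ ∘ (h ^ toℕ j) , (toℕ j , κ , Kκ , λ c → refl) , ∙-congˡ (h ^ toℕ j) Sκ∼rep

      shifted-aligned : ∀ a d k l → d < e → rep k ∙ (h ^ a) ∼ rep l ∙ (h ^ (d + a)) → d ≡ 0 × k ≡ l
      shifted-aligned a d k l d<e eq = d≡0 , rep-injective k l (subst (λ d → rep k ∼ rep l ∙ (h ^ d)) d≡0 rep-k∼)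
        where
        rep-k∼ : rep k ∼ rep l ∙ (h ^ d)
        rep-k∼ = ∙-cancelʳ (^-inverse {p = p} h-order a) (∼-trans eq (∙-congʳ (rep l) (^-+ h d a)))
        d≡0 : d ≡ 0
        d≡0 = period-below-e d d<e (shifted⇒period {d} {l} (k , ∼-sym rep-k∼))

      shifted-injective-≤ : ∀ i j k l → toℕ i ≤ toℕ j → shifted (i , k) ∼ shifted (j , l) → (i , k) ≡ (j , l)
      shifted-injective-≤ i j k l i≤j eq =
        cong₂ _,_ (toℕ-injective (sym (trans j≡d+i (cong (_+ toℕ i) d≡0)))) k≡l
        where
        d = proj₁ (m≤n⇒∃[o]m+o≡n i≤j)
        j≡d+i : toℕ j ≡ d + toℕ i
        j≡d+i = trans (sym (proj₂ (m≤n⇒∃[o]m+o≡n i≤j))) (+-comm (toℕ i) d)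
        d<e : d < e
        d<e = ≤-<-trans (m≤m+n d (toℕ i)) (subst (_< e) j≡d+i (toℕ<n j))
        aligned = shifted-aligned (toℕ i) d k l d<e (subst (λ a → rep k ∙ (h ^ toℕ i) ∼ rep l ∙ (h ^ a)) j≡d+i eq)
        d≡0 = proj₁ aligned
        k≡l = proj₂ aligned

      shifted-injective : ∀ x y → shifted x ∼ shifted y → x ≡ y
      shifted-injective (i , k) (j , l) eq with ≤-total (toℕ i) (toℕ j)
      ... | inj₁ i≤j = shifted-injective-≤ i j k l i≤j eq
      ... | inj₂ j≤i = sym (shifted-injective-≤ j i l k j≤i (∼-sym eq))

      ∼-∙h : ∀ {A B a b} → A ∙ (h ^ a) ∼ B ∙ (h ^ b) → A ∙ (h ^ suc a) ∼ B ∙ (h ^ suc b)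
      ∼-∙h {A} {B} {a} {b} eq =
        ∼-trans (∙-congʳ A (^-suc h a)) (∼-trans (∙-congˡ h eq) (∼-sym (∙-congʳ B (^-suc h b))))

      advance : ∀ i k → ∃ λ x → rep k ∙ (h ^ suc (toℕ i)) ∼ shifted x
      advance i k with m≤n⇒m<n∨m≡n (toℕ<n i)
      ... | inj₁ i+1<e = (fromℕ< i+1<e , k) , ∙-congʳ (rep k) (λ c → cong (λ a → (h ^ a) c) (sym (toℕ-fromℕ< i+1<e)))
      ... | inj₂ i+1≡e = let (k′ , eq) = period⇒shifted {e} period-e k in
        (zero , k′) , subst (λ a → rep k ∙ (h ^ a) ∼ rep k′) (sym i+1≡e) eq

      reduce : ∀ j k → ∃ λ x → rep k ∙ (h ^ j) ∼ shifted x
      reduce zero    k = (zero , k) , ∼-refl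
      reduce (suc j) k = let ((i , k′) , eq) = reduce j k
                             (x , eq′) = advance i k′
                         in x , ∼-trans (∼-∙h {rep k} {rep k′} {j} {toℕ i} eq) eq′

      shifted-complete : ∀ {π} → (K ⟨ h ⟩) π → ∃ λ x → S ∙ π ∼ shifted x
      shifted-complete (j , κ , Kκ , π≗) =
        let (k , Sκ∼rep) = rep-complete Kκ
            (x , eq) = reduce j k
        in x , ∼-trans (∙-congʳ S π≗) (∼-trans (∙-congˡ (h ^ j) Sκ∼rep) eq)

      extended-orbit : Orbit (K ⟨ h ⟩) (e * m)
      extended-orbit = record
        { rep           = shifted ∘ remQuot m
        ; rep-∈         = shifted-∈ ∘ remQuot m
        ; rep-injective = λ x y eq → trans (sym (combine-remQuot {e} m x))
            (trans (cong (uncurry combine) (shifted-injective (remQuot m x) (remQuot m y) eq)) (combine-remQuot {e} m y))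
        ; rep-complete  = λ {π} Kh-π → let ((j , k) , Sπ∼) = shifted-complete Kh-π in
            combine j k , subst (S ∙ π ∼_) (cong shifted (sym (remQuot-combine j k))) Sπ∼
        }

    series-orbit : ∀ {hs q} → PolycyclicSeries hs q → ∃ λ m → m ∣ q × Orbit (Generated hs) m
    series-orbit trivial = 1 , ∣-refl , trivial-orbit
    series-orbit (extend {hs} h p series h-order conj) =
      let (m , m∣q , orbit) = series-orbit series
          K-sub = series-subgroup series
          open Extension {p = p} K-sub (conjugates-generated hs K-sub conj) h-order orbit
      in e * m , *-pres-∣ e∣order m∣q , extended-orbit

  module _ {gens : List Word} where

    inGroup-++ : ∀ {w v} → InGroup gens w → InGroup gens v → InGroup gens (w ++ v)
    inGroup-++ ε v∈ = v∈
    inGroup-++ {v = v} (gen {w} {u} w∈gens u∈) v∈ =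
      subst (InGroup gens) (sym (++-assoc w u v)) (gen w∈gens (inGroup-++ u∈ v∈))
    inGroup-++ {v = v} (gen⁻ {w} {u} w∈gens u∈) v∈ =
      subst (InGroup gens) (sym (++-assoc (invW w) u v)) (gen⁻ w∈gens (inGroup-++ u∈ v∈))

    inGroup-generator : ∀ {w} → w ∈ gens → InGroup gens w
    inGroup-generator {w} w∈gens = subst (InGroup gens) (++-identityʳ w) (gen w∈gens ε)

    Realised : Endo → Set
    Realised π = ∃ λ w → InGroup gens w × π ≗ pos w

    realised-∘ : ∀ {π ρ} → Realised π → Realised ρ → Realised (π ∘ ρ)
    realised-∘ {π} {ρ} (w , w∈ , π≗) (v , v∈ , ρ≗) =
      v ++ w , inGroup-++ v∈ w∈ , λ c → trans (trans (π≗ (ρ c)) (cong (pos w) (ρ≗ c))) (sym (pos-++ v w c))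

    realised-^ : ∀ {π} → Realised π → ∀ k → Realised (π ^ k)
    realised-^ π-real zero    = [] , ε , λ c → refl
    realised-^ π-real (suc k) = realised-∘ π-real (realised-^ π-real k)

    generated-realised : ∀ {hs} → All Realised hs → ∀ {π} → Generated hs π → Realised π
    generated-realised [] π≗id = [] , ε , π≗id
    generated-realised (h-real ∷ hs-real) (j , κ , Gκ , π≗) =
      let (w , w∈ , κhʲ≗) = realised-∘ (generated-realised hs-real Gκ) (realised-^ h-real j) in
      w , w∈ , λ c → trans (π≗ c) (κhʲ≗ c)

    module _ {K} (K-sub : IsSubgroup K) (gens∈K : ∀ {w} → w ∈ gens → K (pos w)) where
      open IsSubgroup K-sub

      -- a right inverse of pos w coincides with its left inverse pos (invW w)
      invW-∈ : ∀ {w} → w ∈ gens → K (pos (invW w))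
      invW-∈ {w} w∈gens = let (ρ , Kρ , wρ≗id) = inverse (gens∈K w∈gens) in
        ∈-resp (λ c → trans (sym (pos-invW w (ρ c))) (cong (pos (invW w)) (wρ≗id c))) Kρ

      inGroup-∈ : ∀ {w} → InGroup gens w → K (pos w)
      inGroup-∈ ε = id-∈
      inGroup-∈ (gen {w} {v} w∈gens v∈) =
        ∈-resp (λ c → sym (pos-++ w v c)) (∘-∈ (inGroup-∈ v∈) (gens∈K w∈gens))
      inGroup-∈ (gen⁻ {w} {v} w∈gens v∈) =
        ∈-resp (λ c → sym (pos-++ (invW w) v c)) (∘-∈ (inGroup-∈ v∈) (invW-∈ w∈gens))

  orbit-size-divides : ∀ {hs q} S → Onto S → ∀ gens → PolycyclicSeries hs q →
    (∀ {w} → w ∈ gens → ∃ λ h → h ∈ hs × pos w ≗ h) →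
    All (λ h → ∃ λ w → w ∈ gens × h ≗ pos w) hs →
    OrbitSizeDivides gens S q
  orbit-size-divides {hs} S S-onto gens series gens-in-hs hs-in-gens =
    m , (rep , witness , rep-injective , complete) , m∣q
    where
    open IsSubgroup (series-subgroup series)
    m = proj₁ (series-orbit S S-onto series)
    m∣q = proj₁ (proj₂ (series-orbit S S-onto series))
    open Orbit (proj₂ (proj₂ (series-orbit S S-onto series)))

    hs-realised : All (Realised {gens}) hs
    hs-realised = All.map (λ (w , w∈ , h≗) → w , inGroup-generator w∈ , h≗) hs-in-gens

    gens-generated : ∀ {w} → w ∈ gens → Generated hs (pos w)
    gens-generated w∈ = let (h , h∈ , pos≗h) = gens-in-hs w∈ in
      ∈-resp (λ c → sym (pos≗h c)) (generator-generated h∈)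

    witness : ∀ k → ∃ λ w → InGroup gens w × act w S ∼ rep k
    witness k = let (κ , Gκ , Sκ∼rep) = rep-∈ k
                    (w , w∈ , κ≗) = generated-realised hs-realised Gκ
                in w , w∈ , ∼-trans (act-∼ w S) (∼-trans (∙-congʳ S (λ c → sym (κ≗ c))) Sκ∼rep)

    complete : ∀ w → InGroup gens w → ∃ λ k → act w S ∼ rep k
    complete w w∈ = let (k , Sw∼rep) = rep-complete (inGroup-∈ (series-subgroup series) gens-generated w∈) in
      k , ∼-trans (act-∼ w S) Sw∼rep

order-U : ∀ t → suc (2 * t + 1) * suc t ≡ 2 * (suc t * suc t)
order-U = solve-∀

order-V : ∀ t → suc t * (2 * suc t) ≡ 2 * (suc t * suc t)
order-V = solve-∀

conjugate-V : ∀ t → 2 * suc t + t * (2 * suc t) ≡ 2 * (suc t * suc t)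
conjugate-V = solve-∀

conjugate-U-by-F : ∀ t → suc t + (suc t + t * (2 * suc t)) ≡ 2 * (suc t * suc t)
conjugate-U-by-F = solve-∀

conjugate-U-by-G : ∀ t → suc t + (2 * t + 1) * suc t ≡ 2 * (suc t * suc t)
conjugate-U-by-G = solve-∀

order-I : ∀ t → 2 * (2 * (suc t * (suc (2 * t + 1) * 1))) ≡ 4 * (2 * (suc t * suc t))
order-I = solve-∀

module _ (t : ℕ) (x : Cell (N t)) where

  c₁ c₂ : ℕ
  c₁ = −1ₙ {N t} + (2 * x₁ t x + 2)
  c₂ = −1ₙ {N t} + (2 * x₂ t x + 1)

  -- (i , j) ↦ (2x₁ + 1 − i , 2x₂ − j)
  halfTurn : Endo {N t}
  halfTurn = reflect c₁ ⊗ reflect c₂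

  halfTurn-order : halfTurn ^ 2 ≗ id
  halfTurn-order = ⊗-involutive {φ = reflect c₁} {ψ = reflect c₂} (reflect-involutive c₁) (reflect-involutive c₂)

  pos-gRot : pos (gRot t x) ≗ halfTurn
  pos-gRot = pos-τ₁τ₂-r² (2 * x₁ t x + 2) (2 * x₂ t x + 1)

module CaseI (t : ℕ) (x : Cell (N t)) where

  U V F G : Endo {N t}
  U = shift (suc t) (suc t)
  V = shift 0 (2 * suc t)
  F = id ⊗ reflect (c₂ t x)
  G = halfTurn t x

  series-U : PolycyclicSeries (U ∷ []) (suc (2 * t + 1) * 1)
  series-U = extend U (2 * t + 1) trivial (shift-^-id (suc (2 * t + 1)) (≡n⇒≡ₙ0 (order-U t)) (≡n⇒≡ₙ0 (order-U t))) []

  series-UV : PolycyclicSeries (V ∷ U ∷ []) (suc t * (suc (2 * t + 1) * 1))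
  series-UV = extend V t series-U (shift-^-id (suc t) (k*0≡ₙ0 (suc t)) (≡n⇒≡ₙ0 (order-V t)))
    ((U , generator-generated {hs = U ∷ []} (here refl) , shift-comm 0 (2 * suc t) (suc t) (suc t)) ∷ [])

  V^t≗ : V ^ t ≗ shift (t * 0) (t * (2 * suc t))
  V^t≗ = shift-^ 0 (2 * suc t) t

  reflect-conjugates-V : ∀ c → reflect {N t} c ∘ subtract (2 * suc t) ≗ subtract (t * (2 * suc t)) ∘ reflect c
  reflect-conjugates-V c = reflect-conjugate c _ _ (≡n⇒≡ₙ0 (conjugate-V t))

  series-UVF : PolycyclicSeries (F ∷ V ∷ U ∷ []) (2 * (suc t * (suc (2 * t + 1) * 1)))
  series-UVF = extend F 1 series-UV (⊗-involutive {φ = id} {ψ = reflect (c₂ t x)} (λ _ → refl) (reflect-involutive (c₂ t x)))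
    ( (V ^ t , ^-∈ {π = V} V∈ t , F∘V)
    ∷ (U ∘ (V ^ t) , ∘-∈ U∈ (^-∈ {π = V} V∈ t) , F∘U)
    ∷ [])
    where
    open IsSubgroup (series-subgroup series-UV)
    U∈ = generator-generated {hs = V ∷ U ∷ []} (there (here refl))
    V∈ = generator-generated {hs = V ∷ U ∷ []} (here refl)
    F∘V : F ∘ V ≗ (V ^ t) ∘ F
    F∘V = conjugate-via V^t≗ (⊗-conjugate (subtract-cong (sym (k*0≡ₙ0 t))) (reflect-conjugates-V (c₂ t x)))
    F∘U : F ∘ U ≗ (U ∘ (V ^ t)) ∘ F
    F∘U = conjugate-via (λ c → trans (cong U (V^t≗ c)) (shift-∘ (suc t) (suc t) (t * 0) (t * (2 * suc t)) c))
      (⊗-conjugate (subtract-cong (a≡ₙa+k*0 {N t} (suc t) t))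
                   (reflect-conjugate (c₂ t x) _ _ (≡n⇒≡ₙ0 (conjugate-U-by-F t))))

  series-UVFG : PolycyclicSeries (G ∷ F ∷ V ∷ U ∷ []) (2 * (2 * (suc t * (suc (2 * t + 1) * 1))))
  series-UVFG = extend G 1 series-UVF (halfTurn-order t x)
    ( (F , F∈ , λ c → refl)
    ∷ (V ^ t , ^-∈ {π = V} V∈ t , G∘V)
    ∷ (U ^ (2 * t + 1) , ^-∈ {π = U} U∈ (2 * t + 1) , G∘U)
    ∷ [])
    where
    open IsSubgroup (series-subgroup series-UVF)
    F∈ = generator-generated {hs = F ∷ V ∷ U ∷ []} (here refl)
    V∈ = generator-generated {hs = F ∷ V ∷ U ∷ []} (there (here refl))
    U∈ = generator-generated {hs = F ∷ V ∷ U ∷ []} (there (there (here refl)))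
    G∘V : G ∘ V ≗ (V ^ t) ∘ G
    G∘V = conjugate-via V^t≗ (⊗-conjugate (reflect-conjugate (c₁ t x) 0 _ (k*0≡ₙ0 t)) (reflect-conjugates-V (c₂ t x)))
    G∘U : G ∘ U ≗ (U ^ (2 * t + 1)) ∘ G
    G∘U = conjugate-via (shift-^ (suc t) (suc t) (2 * t + 1))
      (⊗-conjugate (reflect-conjugate (c₁ t x) _ _ (≡n⇒≡ₙ0 (conjugate-U-by-G t)))
                   (reflect-conjugate (c₂ t x) _ _ (≡n⇒≡ₙ0 (conjugate-U-by-G t))))

  gens-in-series : ∀ {w} → w ∈ gensI t x → ∃ λ h → h ∈ G ∷ F ∷ V ∷ U ∷ [] × pos w ≗ h
  gens-in-series (here refl)                         = U , there (there (there (here refl))) , pos-τ₁τ₂ (suc t) (suc t)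
  gens-in-series (there (here refl))                 = V , there (there (here refl)) , pos-τ₂ (2 * suc t)
  gens-in-series (there (there (here refl)))         = F , there (here refl) , pos-τ₂-s (2 * x₂ t x + 1)
  gens-in-series (there (there (there (here refl)))) = G , here refl , pos-gRot t x

  series-in-gens : All (λ h → ∃ λ w → w ∈ gensI t x × h ≗ pos w) (G ∷ F ∷ V ∷ U ∷ [])
  series-in-gens =
      (gRot t x , there (there (there (here refl))) , λ c → sym (pos-gRot t x c))
    ∷ (_ , there (there (here refl)) , λ c → sym (pos-τ₂-s (2 * x₂ t x + 1) c))
    ∷ (_ , there (here refl) , λ c → sym (pos-τ₂ (2 * suc t) c))
    ∷ (_ , here refl , λ c → sym (pos-τ₁τ₂ (suc t) (suc t) c))
    ∷ []

  orbits : ∀ S → Latin S → OrbitSizeDivides (gensI t x) S (4 * N t)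
  orbits S latin = subst (OrbitSizeDivides (gensI t x) S) (order-I t)
    (orbit-size-divides S (latin-onto latin) (gensI t x) series-UVFG gens-in-series series-in-gens)

module CaseII (t : ℕ) (x : Cell (N t)) (a b : Fin (N t)) where

  T G : Endo {N t}
  T = shift (toℕ a) (toℕ b)
  G = halfTurn t x

  series-T : PolycyclicSeries (T ∷ []) (N t * 1)
  series-T = extend T (−1ₙ {N t}) trivial (shift-order (toℕ a) (toℕ b)) []

  series-TG : PolycyclicSeries (G ∷ T ∷ []) (2 * (N t * 1))
  series-TG = extend G 1 series-T (halfTurn-order t x)
    ((T ^ −1ₙ {N t} , ^-∈ {π = T} (generator-generated {hs = T ∷ []} (here refl)) (−1ₙ {N t}) , G∘T) ∷ [])
    where
    open IsSubgroup (series-subgroup series-T)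
    G∘T : G ∘ T ≗ (T ^ −1ₙ {N t}) ∘ G
    G∘T = conjugate-via (shift-^ (toℕ a) (toℕ b) (−1ₙ {N t}))
      (⊗-conjugate (reflect-conjugate (c₁ t x) _ _ (−1ₙ-negates (toℕ a))) (reflect-conjugate (c₂ t x) _ _ (−1ₙ-negates (toℕ b))))

  gens-in-series : ∀ {w} → w ∈ gensII t x a b → ∃ λ h → h ∈ G ∷ T ∷ [] × pos w ≗ h
  gens-in-series (here refl)         = T , there (here refl) , pos-τ₁τ₂ (toℕ a) (toℕ b)
  gens-in-series (there (here refl)) = G , here refl , pos-gRot t x

  series-in-gens : All (λ h → ∃ λ w → w ∈ gensII t x a b × h ≗ pos w) (G ∷ T ∷ [])
  series-in-gens =
      (gRot t x , there (here refl) , λ c → sym (pos-gRot t x c))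
    ∷ (_ , here refl , λ c → sym (pos-τ₁τ₂ (toℕ a) (toℕ b) c))
    ∷ []

  orbits : ∀ S → Latin S → OrbitSizeDivides (gensII t x a b) S (2 * N t)
  orbits S latin = subst (λ d → OrbitSizeDivides (gensII t x a b) S (2 * d)) (*-identityʳ (N t))
    (orbit-size-divides S (latin-onto latin) (gensII t x a b) series-TG gens-in-series series-in-gens)

theorem10 : (t : ℕ) → 1 ≤ t
    → (C₀ : Code (N t)) → Linear C₀ → DiameterPerfect t C₀
    → (x : Cell (N t))
    → (e : Fin (N t) → Cell (N t)) → Enumerates (translate x C₀) e
    → (I : Arr (N t)) → IsPalette t e I
    → ((Equivalent C₀ (C′ t)
          → ∀ S → IsDPSudoku I S → OrbitSizeDivides (gensI t x) S (4 * N t))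
       × (∀ a b → GeneratorMatrix ((a , b) ∷ []) C₀ → Equivalent C₀ (C″ t)
          → ∀ S → IsDPSudoku I S → OrbitSizeDivides (gensII t x a b) S (2 * N t)))
theorem10 t _ _ _ _ x _ _ _ _ =
  (λ _ S (latin , _) → CaseI.orbits t x S latin) ,
  (λ a b _ _ S (latin , _) → CaseII.orbits t x a b S latin)
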